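{- Let $\mathcal T=\{\tau_1,\dots,\tau_m\}$ be state sequences, each of length $n$, and $\mathcal C=\{C_1,\dots,C_k\}$ a set of criteria that are all monotone decreasing and independent. Let $G$, $\ell$, $V_i$, $M(\cdot)$ and $D_i$ be as defined in the context. Then the total size $\sum_{i=1}^{\ell-1}|D_i|$ of all the sets $D_i$ is $O(k(n+1)^m)$.
   Context: A criterion $C$ is independent if it is a predicate on single contiguous subsequences of a single state sequence, and a set of segments fulfils $C$ iff each of its segments does. $C$ is monotone decreasing if whenever a subsequence fulfils $C$, every contiguous subsequence of it fulfils $C$. For $0\le a<b\le n$, $\tau_i[a+1,b]$ denotes the contiguous subsequence of states $a+1,\dots,b$ of $\tau_i$. The prefix graph $G$ has as vertices all grid points $(x_1,\dots,x_m)$ with $0\le x_i\le n$, plus an extra vertex $v_t$; $v_s=(0,\dots,0)$. There is a directed edge labelled $C_j$ from $(x_1,\dots,x_m)$ to $(x'_1,\dots,x'_m)$ iff for every $i$ either $x_i=x'_i$ or $x_i<x'_i$, and the subsequences $\tau_i[x_i+1,x'_i]$ for all $i$ with $x_i<x'_i$ jointly fulfil $C_j$; additionally there is an edge from $(n,\dots,n)$ to $v_t$. $\ell$ is the distance from $v_s$ to $v_t$ in $G$, and $V_i$ is the set of vertices reachable from $v_s$ in exactly $i$ steps. A grid vertex $p$ dominates $p'$ if every coordinate of $p$ is at least the corresponding coordinate of $p'$ and at least one is strictly larger; $M(V)$ is the set of vertices of $V$ not dominated by any vertex of $V$. For $i\ge1$, $D_i$ is the set of vertices obtained as follows: for each $u=(x_1,\dots,x_m)\in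 M(V_{i-1})$ and each criterion $C\in\mathcal C$, take the vertex $(x'_1,\dots,x'_m)$ where, for each $j$, $x'_j$ is the largest index $\ge x_j$ such that $x'_j=x_j$ or $\tau_j[x_j+1,x'_j]$ fulfils $C$ (the farthest vertex reachable from $u$ using $C$). -}

module Defs where

open import Data.Nat using (ℕ; zero; suc; _+_; _∸_; _≤_; _<_)
open import Data.Fin using (Fin; toℕ)
open import Data.Vec using (Vec; lookup; replicate)
import Data.Vec as Vec
open import Data.List using (List; []; _++_; take; drop)
open import Data.Product using (Σ; ∃; _×_; _,_)
open import Data.Sum using (_⊎_)
open import Data.Empty using (⊥)
open import Relation.Nullary using (¬_)
open import Relation.Binary.PropositionalEquality using (_≡_; _≢_)

-- Independence is built in: a set of
-- segments fulfils a criterion iff each of its segments does (see `Edge`).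
Criterion : Set → Set₁
Criterion S = List S → Set

MonotoneDecreasing : {S : Set} → Criterion S → Set
MonotoneDecreasing {S} C =
  (xs ys zs : List S) → C (xs ++ ys ++ zs) → ys ≢ [] → C ys

-- τ[a+1,b] : the states a+1,…,b (1-based) of τ.
segment : {S : Set} {n : ℕ} → Vec S n → ℕ → ℕ → List S
segment τ a b = take (b ∸ a) (drop a (Vec.toList τ))

Grid : ℕ → ℕ → Set
Grid m n = Vec (Fin (suc n)) m

coord : {m n : ℕ} → Grid m n → Fin m → ℕ
coord x i = toℕ (lookup x i)

data Vertex (m n : ℕ) : Set where
  grid : Grid m n → Vertex m n
  vt   : Vertex m n

module Setup {S : Set} {m n k : ℕ}
             (τ : Fin m → Vec S n) (𝒞 : Fin k → Criterion S) where

  vs : Grid m n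
  vs = replicate m Data.Fin.zero

  vn : Grid m n
  vn = replicate m (Data.Fin.fromℕ n)

  LabelledEdge : Criterion S → Grid m n → Grid m n → Set
  LabelledEdge C x x' = (i : Fin m) →
    (coord x i ≡ coord x' i) ⊎
    ((coord x i < coord x' i) × C (segment (τ i) (coord x i) (coord x' i)))

  data Edge : Vertex m n → Vertex m n → Set where
    cedge : {x x' : Grid m n} (j : Fin k) → LabelledEdge (𝒞 j) x x' →
            Edge (grid x) (grid x')
    tedge : Edge (grid vn) vt

  data V : ℕ → Vertex m n → Set where
    start : V zero (grid vs)
    step  : {i : ℕ} {u v : Vertex m n} → V i u → Edge u v → V (suc i) v

  IsDistance : ℕ → Set
  IsDistance ℓ = V ℓ vt × ((j : ℕ) → j < ℓ → ¬ V j vt)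

  Dominates : Grid m n → Grid m n → Set
  Dominates p p' = ((i : Fin m) → coord p' i ≤ coord p i) ×
                   (∃ λ i → coord p' i < coord p i)

  M : ℕ → Grid m n → Set
  M i u = V i (grid u) × ((w : Grid m n) → V i (grid w) → ¬ Dominates w u)

  Farthest : Criterion S → Grid m n → Grid m n → Set
  Farthest C u v = (j : Fin m) →
    (coord u j ≤ coord v j) ×
    ((coord u j ≡ coord v j) ⊎ C (segment (τ j) (coord u j) (coord v j))) ×
    ((y : ℕ) → y ≤ n → coord u j < y → C (segment (τ j) (coord u j) y) →
       y ≤ coord v j)

  -- Membership in D_i (only defined for i ≥ 1; D 0 is empty by convention,
  -- and is never used).
  D : ℕ → Grid m n → Set
  D zero    v = ⊥
  D (suc i) v = ∃ λ u → M i u × ∃ λ (j : Fin k) → Farthest (𝒞 j) u v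

sum1to : ℕ → (ℕ → ℕ) → ℕ
sum1to zero    f = 0
sum1to (suc b) f = sum1to b f + f (suc b)

-- Every member of D_{a+1} is the farthest vertex reached from some u ∈ M(V_a)
-- with some criterion C, and it is determined by the pair (u, C).  It therefore
-- suffices that no grid point lies in two of the sets M(V_a), a < ℓ - 1; then the
-- pairs (u, C) coding the members of D_1, …, D_{ℓ-1} are pairwise distinct, and
-- there are only k (n+1)^m of them.  Suppose u ∈ M(V_a) ∩ M(V_b) with a < b.
-- If u = (n,…,n) then v_t is reached in a + 1 < ℓ steps.  Otherwise u_j < n for
-- some j, and no criterion accepts the single state u_j + 1 of τ_j: else raising
-- u_j by one is an edge, and with self-loops the raised vertex lies in V_b and
-- dominates u.  By monotonicity no edge then crosses that state, so coordinate j
-- never exceeds u_j and v_t is unreachable.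

module Submission where

open import Defs
open import Data.Nat using (ℕ; suc; _*_; _^_; _∸_; _≤_; _<_)
open import Data.Fin using (Fin)
open import Data.Vec using (Vec)
open import Data.List using (List; length)
open import Data.List.Relation.Unary.All using (All)
open import Data.List.Relation.Unary.Unique.Propositional using (Unique)
open import Data.Product using (Σ; _×_)

open import Data.Nat using (zero; z≤n; s≤s; _+_; _≤′_; ≤′-refl; ≤′-step; _≤?_; _<?_)
open import Data.Nat.Properties
open import Data.Fin as Fin using (toℕ; fromℕ; fromℕ<; combine; funToFin)
open import Data.Fin.Properties
  using (toℕ-injective; toℕ<n; toℕ-fromℕ; toℕ-fromℕ<; all?; ¬∀⟶∃¬; combine-injective;
         finToFun-funToFin; injective⇒≤)
  renaming (_≟_ to _≟ᶠ_)
open import Data.Vec using (lookup; updateAt; tabulate; toList)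
open import Data.Vec.Properties
  using (lookup∘updateAt; lookup∘updateAt′; lookup-replicate; length-toList; tabulate∘lookup;
         tabulate-cong)
open import Data.List as List using ([]; _∷_; _++_; take; drop)
open import Data.List.Properties using (length-++; take-[]; drop-[])
import Data.List.Relation.Unary.All as All
open import Data.List.Relation.Unary.AllPairs using ([]; _∷_)
open import Data.List.Relation.Unary.Any using (here; there)
import Data.List.Relation.Unary.Unique.Propositional.Properties as Unique
open import Data.List.Membership.Propositional using (_∈_)
open import Data.List.Membership.Propositional.Properties using (∈-lookup; ∈-++⁻)
open import Data.Product using (_,_; proj₁; proj₂; ∃; ∃₂; map₂)
open import Data.Sum using (_⊎_; inj₁; inj₂)
open import Data.Empty using (⊥)
open import Function using (_∘_; Injective)
open import Relation.Binary using (tri<; tri≈; tri>)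
open import Relation.Nullary using (¬_; yes; no; contradiction)
open import Relation.Binary.PropositionalEquality

take-drop-infix : ∀ {A : Set} (xs : List A) {y s x} → y ≤ s → s < x →
                  ∃₂ λ P Q → take (x ∸ y) (drop y xs) ≡ P ++ take 1 (drop s xs) ++ Q
take-drop-infix {A} [] {y} {s} {x} _ _
  rewrite drop-[] {A = A} y | drop-[] {A = A} s | take-[] {A = A} (x ∸ y) = [] , [] , refl
take-drop-infix (e ∷ xs) {zero} {zero} {suc x} _ _ = [] , take x xs , refl
take-drop-infix (e ∷ xs) {zero} {suc s} {suc x} _ (s≤s s<x)
  with P , Q , eq ← take-drop-infix xs {zero} z≤n s<x = e ∷ P , Q , cong (e ∷_) eq
take-drop-infix (e ∷ xs) {suc y} {suc s} {suc x} (s≤s y≤s) (s≤s s<x) =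
  take-drop-infix xs y≤s s<x

take-1-drop-≢[] : ∀ {A : Set} (xs : List A) {s} → s < length xs → take 1 (drop s xs) ≢ []
take-1-drop-≢[] (e ∷ xs) {zero}  _         ()
take-1-drop-≢[] (e ∷ xs) {suc s} (s≤s s<) = take-1-drop-≢[] xs s<

segment-unit : ∀ {S : Set} {n} (τ : Vec S n) s →
               segment τ s (suc s) ≡ take 1 (drop s (toList τ))
segment-unit τ s = cong (λ d → take d (drop s (toList τ))) (m+n∸n≡m 1 s)

unit-segment-fulfils : ∀ {S : Set} {n} {C : Criterion S} → MonotoneDecreasing C →
                       (τ : Vec S n) {y s x : ℕ} → y ≤ s → s < x → s < n →
                       C (segment τ y x) → C (segment τ s (suc s))
unit-segment-fulfils {C = C} mono τ {s = s} y≤s s<x s<n C[y,x]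
  with P , Q , split ← take-drop-infix (toList τ) y≤s s<x =
  subst C (sym (segment-unit τ s))
    (mono P _ Q (subst C split C[y,x])
      (take-1-drop-≢[] (toList τ) (subst (s <_) (sym (length-toList τ)) s<n)))

lookup-ext : ∀ {A : Set} {m} {xs ys : Vec A m} → (∀ i → lookup xs i ≡ lookup ys i) → xs ≡ ys
lookup-ext {xs = xs} {ys} eq = begin
  xs                 ≡⟨ tabulate∘lookup xs ⟨
  tabulate (lookup xs) ≡⟨ tabulate-cong eq ⟩
  tabulate (lookup ys) ≡⟨ tabulate∘lookup ys ⟩
  ys                 ∎
  where open ≡-Reasoning

List-lookup-injective : ∀ {A : Set} {xs : List A} → Unique xs → Injective _≡_ _≡_ (List.lookup xs)
List-lookup-injective (x∉xs ∷ u) {Fin.zero}  {Fin.zero}  _  = refl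
List-lookup-injective (x∉xs ∷ u) {Fin.zero}  {Fin.suc j} eq = contradiction eq (All.lookup x∉xs (∈-lookup j))
List-lookup-injective (x∉xs ∷ u) {Fin.suc i} {Fin.zero}  eq = contradiction (sym eq) (All.lookup x∉xs (∈-lookup i))
List-lookup-injective (x∉xs ∷ u) {Fin.suc i} {Fin.suc j} eq = cong Fin.suc (List-lookup-injective u eq)

Unique⇒length≤ : ∀ {N} {zs : List (Fin N)} → Unique zs → length zs ≤ N
Unique⇒length≤ u = injective⇒≤ (List-lookup-injective u)

-- R i x z reads "z codes x at level i".
module Counting {A : Set} {N : ℕ} (R : ℕ → A → Fin N → Set) where

  codes : ∀ {i xs} → All (λ x → ∃ (R i x)) xs → List (Fin N)
  codes = All.reduce proj₁

  length-codes : ∀ {i xs} (ps : All (λ x → ∃ (R i x)) xs) → length (codes ps) ≡ length xs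
  length-codes All.[]       = refl
  length-codes (p All.∷ ps) = cong suc (length-codes ps)

  ∈-codes : ∀ {i xs z} (ps : All (λ x → ∃ (R i x)) xs) → z ∈ codes ps → ∃ λ x → x ∈ xs × R i x z
  ∈-codes ((_ , r) All.∷ ps) (here refl) = _ , here refl , r
  ∈-codes (p All.∷ ps) (there z∈) with x , x∈ , r ← ∈-codes ps z∈ = x , there x∈ , r

  codes-unique : ∀ {i xs} → (∀ {x x' z} → R i x z → R i x' z → x ≡ x') →
                 Unique xs → (ps : All (λ x → ∃ (R i x)) xs) → Unique (codes ps)
  codes-unique inj []          All.[]              = []
  codes-unique inj (x∉xs ∷ u) ((z , r) All.∷ ps) =
    All.tabulate z≢ ∷ codes-unique inj u ps
    where
      z≢ : ∀ {z'} → z' ∈ codes ps → z ≢ z'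
      z≢ z'∈ refl with x' , x'∈ , r' ← ∈-codes ps z'∈ = All.lookup x∉xs x'∈ (inj r r')

  module _ (L : ℕ → List A) where

    Levels : ℕ → Set
    Levels b = ∀ i → 1 ≤ i → i ≤ b → Unique (L i) × All (λ x → ∃ (R i x)) (L i)

    Separating : ℕ → Set
    Separating b = ∀ {i i' x x' z} → i ≤ b → i' ≤ b → R i x z → R i' x' z → i ≡ i' × x ≡ x'

    Levels-pred : ∀ {b} → Levels (suc b) → Levels b
    Levels-pred h i 1≤i i≤b = h i 1≤i (m≤n⇒m≤1+n i≤b)

    Levels-top : ∀ {b} → Levels (suc b) → Unique (L (suc b)) × All (λ x → ∃ (R (suc b) x)) (L (suc b))
    Levels-top h = h _ (s≤s z≤n) ≤-refl

    Separating-pred : ∀ {b} → Separating (suc b) → Separating b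
    Separating-pred sep i≤b i'≤b = sep (m≤n⇒m≤1+n i≤b) (m≤n⇒m≤1+n i'≤b)

    allCodes : ∀ b → Levels b → List (Fin N)
    allCodes zero    h = []
    allCodes (suc b) h = allCodes b (Levels-pred h) ++ codes (proj₂ (Levels-top h))

    length-allCodes : ∀ b (h : Levels b) → length (allCodes b h) ≡ sum1to b (λ i → length (L i))
    length-allCodes zero    h = refl
    length-allCodes (suc b) h = begin
      length (previous ++ codes new)              ≡⟨ length-++ previous ⟩
      length previous + length (codes new)        ≡⟨ cong₂ _+_ (length-allCodes b _) (length-codes new) ⟩
      sum1to b (λ i → length (L i)) + length (L (suc b)) ∎
      where
        open ≡-Reasoning
        previous = allCodes b (Levels-pred h)
        new = proj₂ (Levels-top h)

    ∈-allCodes : ∀ b (h : Levels b) {z} → z ∈ allCodes b h → ∃₂ λ i x → i ≤ b × R i x z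
    ∈-allCodes (suc b) h z∈ with ∈-++⁻ (allCodes b _) z∈
    ... | inj₁ z∈₁ with i , x , i≤b , r ← ∈-allCodes b _ z∈₁ = i , x , m≤n⇒m≤1+n i≤b , r
    ... | inj₂ z∈₂ with x , _ , r ← ∈-codes _ z∈₂ = suc b , x , ≤-refl , r

    allCodes-unique : ∀ b (h : Levels b) → Separating b → Unique (allCodes b h)
    allCodes-unique zero    h sep = []
    allCodes-unique (suc b) h sep =
      Unique.++⁺ (allCodes-unique b _ (Separating-pred sep))
                 (codes-unique (λ r r' → proj₂ (sep ≤-refl ≤-refl r r')) (proj₁ (Levels-top h)) _)
                 disjoint
      where
        disjoint : ∀ {z} → ¬ (z ∈ allCodes b _ × z ∈ codes _)
        disjoint (z∈₁ , z∈₂)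
          with i , _ , i≤b , r ← ∈-allCodes b _ z∈₁ | _ , _ , r' ← ∈-codes _ z∈₂ =
          <-irrefl (proj₁ (sep (m≤n⇒m≤1+n i≤b) ≤-refl r r')) (s≤s i≤b)

    sum-length≤ : ∀ b → Levels b → Separating b → sum1to b (λ i → length (L i)) ≤ N
    sum-length≤ b h sep =
      subst (_≤ N) (length-allCodes b h) (Unique⇒length≤ (allCodes-unique b h sep))

coord-ext : ∀ {m n} {x y : Grid m n} → (∀ i → coord x i ≡ coord y i) → x ≡ y
coord-ext eq = lookup-ext (toℕ-injective ∘ eq)

coord≤n : ∀ {m n} (x : Grid m n) i → coord x i ≤ n
coord≤n x i = ≤-pred (toℕ<n (lookup x i))

encode : ∀ {m n k} → Grid m n → Fin k → Fin (k * suc n ^ m)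
encode u j = combine j (funToFin (lookup u))

encode-injective : ∀ {m n k} {u u' : Grid m n} {j j' : Fin k} →
                   encode u j ≡ encode u' j' → u ≡ u' × j ≡ j'
encode-injective {u = u} {u'} {j} {j'} eq
  with j≡j' , f≡f' ← combine-injective j _ j' _ eq =
  lookup-ext (λ i → begin
    lookup u i                              ≡⟨ finToFun-funToFin (lookup u) i ⟨
    Fin.finToFun (funToFin (lookup u)) i    ≡⟨ cong (λ f → Fin.finToFun f i) f≡f' ⟩
    Fin.finToFun (funToFin (lookup u')) i   ≡⟨ finToFun-funToFin (lookup u') i ⟩
    lookup u' i                             ∎) , j≡j'
  where open ≡-Reasoning

bump : ∀ {m n} (u : Grid m n) (j : Fin m) → coord u j < n → Grid m n
bump u j u_j<n = updateAt u j (λ _ → fromℕ< (s≤s u_j<n))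

coord-bump-≡ : ∀ {m n} (u : Grid m n) j (lt : coord u j < n) → coord (bump u j lt) j ≡ suc (coord u j)
coord-bump-≡ u j lt = trans (cong toℕ (lookup∘updateAt j u)) (toℕ-fromℕ< (s≤s lt))

coord-bump-≢ : ∀ {m n} (u : Grid m n) j (lt : coord u j < n) {i} → i ≢ j →
               coord (bump u j lt) i ≡ coord u i
coord-bump-≢ u j lt {i} i≢j = cong toℕ (lookup∘updateAt′ i j i≢j u)

≤∸1⇒< : ∀ {i ℓ} → suc i ≤ ℓ ∸ 1 → suc i < ℓ
≤∸1⇒< {ℓ = suc ℓ} le = s≤s le

module PrefixGraph {S : Set} {m n k : ℕ} (τ : Fin m → Vec S n) (𝒞 : Fin k → Criterion S)
                   (mono : (j : Fin k) → MonotoneDecreasing (𝒞 j)) where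
  open Setup τ 𝒞

  coord-vs : ∀ i → coord vs i ≡ 0
  coord-vs i = cong toℕ (lookup-replicate i Fin.zero)

  coord-vn : ∀ i → coord vn i ≡ n
  coord-vn i = trans (cong toℕ (lookup-replicate i (fromℕ n))) (toℕ-fromℕ n)

  vn-or-coord<n : (u : Grid m n) → u ≡ vn ⊎ ∃ λ j → coord u j < n
  vn-or-coord<n u with all? (λ j → coord u j ≟ n)
  ... | yes all-n = inj₁ (coord-ext (λ j → trans (all-n j) (sym (coord-vn j))))
  ... | no ¬all-n with j , u_j≢n ← ¬∀⟶∃¬ m _ (λ j → coord u j ≟ n) ¬all-n =
    inj₂ (j , ≤∧≢⇒< (coord≤n u j) u_j≢n)

  V-≤ : ∀ {a b x} → Fin k → a ≤ b → V a (grid x) → V b (grid x)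
  V-≤ c a≤b = go (≤⇒≤′ a≤b)
    where
      go : ∀ {a b x} → a ≤′ b → V a (grid x) → V b (grid x)
      go ≤′-refl        v = v
      go (≤′-step a≤′b) v = step (go a≤′b v) (cedge c (λ _ → inj₁ refl))

  Blocked : Fin m → ℕ → Set
  Blocked j s = (c : Fin k) → ¬ 𝒞 c (segment (τ j) s (suc s))

  Blocked⇒coord≤ : ∀ {j s t x} → Blocked j s → s < n → V t (grid x) → coord x j ≤ s
  Blocked⇒coord≤ {j} {s} blocked s<n start = subst (_≤ s) (sym (coord-vs j)) z≤n
  Blocked⇒coord≤ {j} {s} {x = x} blocked s<n (step p (cedge c e))
    with Blocked⇒coord≤ blocked s<n p | e j
  ... | y≤s | inj₁ eq = subst (_≤ s) eq y≤s
  ... | y≤s | inj₂ (_ , C[y,x]) with coord x j ≤? s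
  ...   | yes x≤s = x≤s
  ...   | no  x≰s =
    contradiction (unit-segment-fulfils (mono c) (τ j) y≤s (≰⇒> x≰s) s<n C[y,x]) (blocked c)

  Blocked⇒¬V-vt : ∀ {j s t} → Blocked j s → s < n → ¬ V t vt
  Blocked⇒¬V-vt {j} blocked s<n (step p tedge) =
    <⇒≱ s<n (subst (_≤ _) (coord-vn j) (Blocked⇒coord≤ blocked s<n p))

  bump-edge : ∀ {c u j} (lt : coord u j < n) → 𝒞 c (segment (τ j) (coord u j) (suc (coord u j))) →
              LabelledEdge (𝒞 c) u (bump u j lt)
  bump-edge {c} {u} {j} lt C i with i ≟ᶠ j
  ... | yes refl = inj₂ (subst (coord u j <_) (sym (coord-bump-≡ u j lt)) ≤-refl ,
                         subst (𝒞 c ∘ segment (τ j) (coord u j)) (sym (coord-bump-≡ u j lt)) C)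
  ... | no  i≢j  = inj₁ (sym (coord-bump-≢ u j lt i≢j))

  bump-dominates : ∀ {u j} (lt : coord u j < n) → Dominates (bump u j lt) u
  bump-dominates {u} {j} lt = ≤-bump , j , subst (coord u j <_) (sym (coord-bump-≡ u j lt)) ≤-refl
    where
      ≤-bump : ∀ i → coord u i ≤ coord (bump u j lt) i
      ≤-bump i with i ≟ᶠ j
      ... | yes refl = subst (coord u j ≤_) (sym (coord-bump-≡ u j lt)) (n≤1+n _)
      ... | no  i≢j  = ≤-reflexive (sym (coord-bump-≢ u j lt i≢j))

  undominated⇒Blocked : ∀ {a b u j} → V a (grid u) → ((w : Grid m n) → V b (grid w) → ¬ Dominates w u) →
                        a < b → (lt : coord u j < n) → Blocked j (coord u j)
  undominated⇒Blocked {u = u} {j} Va undominated a<b lt c C =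
    undominated (bump u j lt) (V-≤ c a<b (step Va (cedge c (bump-edge {c} {u} {j} lt C))))
      (bump-dominates {u} {j} lt)

  M-disjoint : ∀ {ℓ a b u} → IsDistance ℓ → M a u → M b u → a < b → suc a < ℓ → ⊥
  M-disjoint {u = u} (Vℓ , shortest) (Va , _) (_ , undominated) a<b sa<ℓ with vn-or-coord<n u
  ... | inj₁ refl         = shortest _ sa<ℓ (step Va tedge)
  ... | inj₂ (j , u_j<n) = Blocked⇒¬V-vt (undominated⇒Blocked Va undominated a<b u_j<n) u_j<n Vℓ

  Farthest-≤ : ∀ {C u v v'} → Farthest C u v → Farthest C u v' → ∀ j → coord v' j ≤ coord v j
  Farthest-≤ {u = u} {v} {v'} f f' j with f j | f' j
  ... | u≤v , _ , farthest | _ , inj₁ eq , _ = subst (_≤ coord v j) eq u≤v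
  ... | u≤v , _ , farthest | _ , inj₂ C , _ with coord u j <? coord v' j
  ...   | yes lt = farthest _ (coord≤n v' j) lt C
  ...   | no  ≮  = ≤-trans (≮⇒≥ ≮) u≤v

  Farthest-unique : ∀ {C u v v'} → Farthest C u v → Farthest C u v' → v ≡ v'
  Farthest-unique {C} {u} {v} {v'} f f' =
    coord-ext {x = v} {v'}
      (λ j → ≤-antisym (Farthest-≤ {C} {u} {v'} {v} f' f j) (Farthest-≤ {C} {u} {v} {v'} f f' j))

  Code : ℕ → Grid m n → Fin (k * suc n ^ m) → Set
  Code zero    v z = ⊥
  Code (suc a) v z = ∃₂ λ u j → M a u × Farthest (𝒞 j) u v × encode u j ≡ z

  D⇒Code : ∀ {i v} → D i v → ∃ (Code i v)
  D⇒Code {suc a} (u , Mu , j , f) = encode u j , u , j , Mu , f , refl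

  Code-separating : ∀ {ℓ} → IsDistance ℓ → ∀ {i i' v v' z} → i ≤ ℓ ∸ 1 → i' ≤ ℓ ∸ 1 →
                    Code i v z → Code i' v' z → i ≡ i' × v ≡ v'
  Code-separating dist {suc a} {suc a'} i≤ i'≤ (u , j , Mu , f , refl) (u' , j' , Mu' , f' , eq)
    with encode-injective {u = u} {u'} {j} {j'} (sym eq)
  ... | refl , refl with <-cmp a a'
  ...   | tri< a<a' _ _ = contradiction (≤∸1⇒< i≤) (λ lt → M-disjoint dist Mu Mu' a<a' lt)
  ...   | tri≈ _ refl _ = refl , Farthest-unique {𝒞 j} {u} f f'
  ...   | tri> _ _ a'<a = contradiction (≤∸1⇒< i'≤) (λ lt → M-disjoint dist Mu' Mu a'<a lt)

lemma7 : Σ ℕ λ c →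
    (S : Set) (m n k : ℕ) (τ : Fin m → Vec S n) (𝒞 : Fin k → Criterion S) →
    ((j : Fin k) → MonotoneDecreasing (𝒞 j)) →
    (ℓ : ℕ) → Setup.IsDistance τ 𝒞 ℓ →
    (L : ℕ → List (Grid m n)) →
    ((i : ℕ) → 1 ≤ i → i ≤ ℓ ∸ 1 → Unique (L i) × All (Setup.D τ 𝒞 i) (L i)) →
    sum1to (ℓ ∸ 1) (λ i → length (L i)) ≤ c * k * suc n ^ m
lemma7 = 1 , λ S m n k τ 𝒞 mono ℓ dist L levels →
  let open PrefixGraph τ 𝒞 mono
      open Counting Code
  in begin
    sum1to (ℓ ∸ 1) (λ i → length (L i))
      ≤⟨ sum-length≤ L (ℓ ∸ 1) (λ i 1≤i i≤ → map₂ (All.map D⇒Code) (levels i 1≤i i≤))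
                                (Code-separating dist) ⟩
    k * suc n ^ m
      ≡⟨ cong (_* suc n ^ m) (*-identityˡ k) ⟨
    1 * k * suc n ^ m ∎
  where open ≤-Reasoning
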